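{- Let $k$ be a positive integer and let $T$ be a semi-complete digraph with $n$ vertices that admits an ordering $(v_1,\ldots,v_n)$ of its vertices of width at most $k$. Let $T'$ be the transitive tournament on the same vertex set in which $(v_i,v_j)\in E(T')$ iff $i<j$. Then every $k$-cut of $T$ is a $2k(1+\ln 2k)$-cut of $T'$.
   Context: A simple digraph (no loops, no multiple arcs; opposite arcs allowed) $T$ is semi-complete if for every pair of distinct vertices $v,w$ at least one of $(v,w)$, $(w,v)$ is an arc. The width of an ordering $(v_1,\ldots,v_n)$ is $\max_{1\le t\le n-1}|E(\{v_{t+1},\ldots,v_n\},\{v_1,\ldots,v_t\})|$, where $E(A,B)$ is the set of arcs with tail in $A$ and head in $B$. For a real $r\ge0$, an $r$-cut of a digraph $D$ is a partition $(X,Y)$ of $V(D)$ such that at most $r$ arcs $(u,v)\in E(D)$ have $u\in Y$, $v\in X$. -}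

module Defs where

open import Data.Nat using (ℕ; zero; suc; _+_; _*_; _∸_; _^_; _≤_; _<_)
open import Data.Nat.Properties using (_<?_)
open import Data.Nat using (_!)
open import Data.Bool using (Bool; true; false; if_then_else_; not; _∧_)
open import Data.Fin using (Fin; toℕ)
open import Data.Fin.Permutation using (Permutation′; _⟨$⟩ʳ_; _⟨$⟩ˡ_)
open import Data.List using (List; map; allFin)
open import Data.Nat.ListAction using (sum)
open import Data.Sum using (_⊎_)
open import Relation.Binary.PropositionalEquality using (_≡_; _≢_)
open import Relation.Nullary.Decidable using (⌊_⌋)

Digraph : ℕ → Set
Digraph n = Fin n → Fin n → Bool

-- Simple: no loops (multiple arcs are excluded by the representation;
-- opposite arcs are allowed).
Loopless : ∀ {n} → Digraph n → Set
Loopless {n} E = (v : Fin n) → E v v ≡ false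

SemiComplete : ∀ {n} → Digraph n → Set
SemiComplete {n} E = Loopless E × ((v w : Fin n) → v ≢ w → (E v w ≡ true) ⊎ (E w v ≡ true))
  where open import Data.Product using (_×_)

countPairs : ∀ n → (Fin n → Fin n → Bool) → ℕ
countPairs n P = sum (map (λ u → sum (map (λ w → if P u w then 1 else 0) (allFin n))) (allFin n))

arcsBetween : ∀ {n} → Digraph n → (Fin n → Bool) → (Fin n → Bool) → ℕ
arcsBetween {n} E A B = countPairs n (λ u w → E u w ∧ (A u ∧ B w))

-- An ordering (v_1,...,v_n) is a permutation π with v_{i+1} = π ⟨$⟩ʳ i
-- (0-indexed positions); the position of vertex v is π ⟨$⟩ˡ v.
Ordering : ℕ → Set
Ordering n = Permutation′ n

pos : ∀ {n} → Ordering n → Fin n → ℕ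
pos π v = toℕ (π ⟨$⟩ˡ v)

prefix : ∀ {n} → Ordering n → ℕ → Fin n → Bool
prefix π t v = ⌊ pos π v <? t ⌋

backArcs : ∀ {n} → Digraph n → Ordering n → ℕ → ℕ
backArcs E π t = arcsBetween E (λ v → not (prefix π t v)) (prefix π t)

WidthAtMost : ∀ {n} → Digraph n → Ordering n → ℕ → Set
WidthAtMost {n} E π k = (t : ℕ) → 1 ≤ t → t < n → backArcs E π t ≤ k

transTournament : ∀ {n} → Ordering n → Digraph n
transTournament π u w = ⌊ pos π u <? pos π w ⌋

cutBackArcs : ∀ {n} → Digraph n → (Fin n → Bool) → ℕ
cutBackArcs E X = arcsBetween E (λ v → not (X v)) X

IsCut : ∀ {n} → Digraph n → ℕ → (Fin n → Bool) → Set
IsCut E r X = cutBackArcs E X ≤ r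

-- Real bound without reals.
-- eNum m = Σ_{i=0}^{m} m!/i!, so eNum m / m! is the m-th partial sum of e,
-- increasing to e.
eNum : ℕ → ℕ
eNum zero    = 1
eNum (suc m) = suc m * eNum m + 1

-- e^j ≤ N  ⟺  for every m, (eNum m / m!)^j ≤ N  (the partial sums increase to e)
ExpAtMost : ℕ → ℕ → Set
ExpAtMost j N = (m : ℕ) → eNum m ^ j ≤ N * ((m !) ^ j)

-- The real inequality  c ≤ 2k(1 + ln 2k)  for natural numbers c and k ≥ 1:
-- either c ≤ 2k, or (with j = c - 2k > 0) j ≤ 2k ln(2k), i.e. e^j ≤ (2k)^(2k).
AtMost2k1ln2k : ℕ → ℕ → Set
AtMost2k1ln2k k c = (c ≤ 2 * k) ⊎ ExpAtMost (c ∸ 2 * k) ((2 * k) ^ (2 * k))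

Is2k1ln2kCut : ∀ {n} → Digraph n → ℕ → (Fin n → Bool) → Set
Is2k1ln2kCut E k X = AtMost2k1ln2k k (cutBackArcs E X)

{-# OPTIONS --safe #-}
module Submission where

-- Read the vertices in the order π and record membership in X as a bit string b; the
-- back arcs of the cut X in T′ are then the inversions of b, the pairs i < j with
-- b i = false and b j = true.  For a split point t, every inversion with i < t ≤ j is
-- an arc of the semi-complete T in one of the two directions, hence a back arc of the
-- cut X or of the ordering at t, so (#zeros before t) · (#ones from t) ≤ 2k =: m.  So
-- the d-th zero of b is followed by at most ⌊m/d⌋ ones, and b has at most
-- Σ_{d ≤ m} ⌊m/d⌋ = m + Σ_{2 ≤ d ≤ m} ⌊m/d⌋ inversions.  Finally e ≤ (d/(d−1))^d gives
-- e^⌊m/d⌋ ≤ (d/(d−1))^m, and the product over 2 ≤ d ≤ m telescopes to m^m.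

open import Defs
open import Data.Nat hiding (Ordering)
open import Data.Nat.Properties
open import Data.Nat.DivMod
open import Data.Nat.Tactic.RingSolver using (solve-∀)
open import Data.Bool using (Bool; true; false; if_then_else_; not; _∧_)
open import Data.Fin using (Fin; zero; suc; toℕ)
open import Data.Fin.Permutation using (_⟨$⟩ʳ_; inverseˡ)
open import Data.List using (map; allFin; tabulate)
open import Data.List.Properties using (map-tabulate)
import Data.Nat.ListAction as List
open import Algebra.Properties.Semiring.Sum +-*-semiring
open import Data.Sum using (_⊎_; inj₁; inj₂)
open import Data.Product using (_,_)
open import Function using (_∘_; id)
open import Relation.Binary.PropositionalEquality
open import Relation.Nullary using (yes; no; contradiction)
open import Relation.Nullary.Decidable using (⌊_⌋; isYes≗does)

rising : ℕ → ℕ → ℕ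
rising n zero    = 1
rising n (suc i) = rising n i * (n + i)

^≤rising : ∀ n i → n ^ i ≤ rising n i
^≤rising n zero    = ≤-refl
^≤rising n (suc i) = begin
  n * n ^ i         ≡⟨ *-comm n (n ^ i) ⟩
  n ^ i * n         ≤⟨ *-mono-≤ (^≤rising n i) (m≤m+n n i) ⟩
  rising n i * (n + i) ∎
  where open ≤-Reasoning

rising-suc : ∀ n i → rising n (suc i) ≡ n * rising (suc n) i
rising-suc n zero    = lemma n
  where
  lemma : ∀ n → 1 * (n + 0) ≡ n * 1
  lemma = solve-∀
rising-suc n (suc i) rewrite rising-suc n i | +-suc n i =
  *-assoc n (rising (suc n) i) (suc (n + i))

rising-pascal : ∀ n i → rising (suc n) (suc i) ≡ rising n (suc i) + suc i * rising (suc n) i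
rising-pascal n i rewrite rising-suc n i = lemma n i (rising (suc n) i)
  where
  lemma : ∀ n i r → r * suc (n + i) ≡ n * r + suc i * r
  lemma = solve-∀

-- M! q^M Σ_{i ≤ M} rising n i / (i! q^i): a truncation of M! q^M (1 - 1/q)^(-n)
negBinomialSum : ℕ → ℕ → ℕ → ℕ
negBinomialSum n q zero    = 1
negBinomialSum n q (suc M) = suc M * q * negBinomialSum n q M + rising n (suc M)

eNum*^≤negBinomialSum : ∀ q M → eNum M * q ^ M ≤ negBinomialSum q q M
eNum*^≤negBinomialSum q zero    = ≤-refl
eNum*^≤negBinomialSum q (suc M) = begin
  (suc M * eNum M + 1) * (q * q ^ M)
    ≡⟨ lemma (suc M) q (eNum M) (q ^ M) ⟩
  suc M * q * (eNum M * q ^ M) + q ^ suc M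
    ≤⟨ +-mono-≤ (*-monoʳ-≤ (suc M * q) (eNum*^≤negBinomialSum q M)) (^≤rising q (suc M)) ⟩
  suc M * q * negBinomialSum q q M + rising q (suc M) ∎
  where
  open ≤-Reasoning
  lemma : ∀ s q e x → (s * e + 1) * (q * x) ≡ s * q * (e * x) + q * x
  lemma = solve-∀

negBinomialSum-zero : ∀ q M → negBinomialSum 0 q M ≡ M ! * q ^ M
negBinomialSum-zero q zero    = refl
negBinomialSum-zero q (suc M) rewrite negBinomialSum-zero q M | rising-suc 0 M =
  lemma (suc M) q (M !) (q ^ M)
  where
  lemma : ∀ s q f x → s * q * (f * x) + 0 ≡ (s * f) * (q * x)
  lemma = solve-∀

negBinomialSum-pascal : ∀ n q M →
  negBinomialSum (suc n) q (suc M) ≡ negBinomialSum n q (suc M) + suc M * negBinomialSum (suc n) q M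
negBinomialSum-pascal n q zero    = lemma n q
  where
  lemma : ∀ n q → 1 * q * 1 + 1 * (suc n + 0) ≡ (1 * q * 1 + 1 * (n + 0)) + 1 * 1
  lemma = solve-∀
negBinomialSum-pascal n q (suc M) = begin
  suc (suc M) * q * negBinomialSum (suc n) q (suc M) + rising (suc n) (suc (suc M))
    ≡⟨ cong₂ (λ a b → suc (suc M) * q * a + b) (negBinomialSum-pascal n q M) (rising-pascal n (suc M)) ⟩
  suc (suc M) * q * (V + suc M * W) + (x + suc (suc M) * y)
    ≡⟨ lemma (suc M) q V W x y ⟩
  (suc (suc M) * q * V + x) + suc (suc M) * (suc M * q * W + y) ∎
  where
  open ≡-Reasoning
  V = negBinomialSum n q (suc M)
  W = negBinomialSum (suc n) q M
  x = rising n (suc (suc M))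
  y = rising (suc n) (suc M)
  lemma : ∀ s q a b x y → suc s * q * (a + s * b) + (x + suc s * y) ≡
                         (suc s * q * a + x) + suc s * (s * q * b + y)
  lemma = solve-∀

-- Σ_{i ≤ M} C(n+i−1, i) x^i ≤ (1 − x)^(−n) with x = 1/(r+1), denominators cleared.
negBinomialSum-bound : ∀ r n M → negBinomialSum n (suc r) M * r ^ n ≤ M ! * suc r ^ (n + M)
negBinomialSum-bound r zero M rewrite negBinomialSum-zero (suc r) M = ≤-reflexive (*-identityʳ _)
negBinomialSum-bound r (suc n) zero = begin
  1 * r ^ suc n       ≡⟨ *-identityˡ _ ⟩
  r ^ suc n           ≤⟨ ^-monoˡ-≤ (suc n) (n≤1+n r) ⟩
  suc r ^ suc n       ≡⟨ sym (*-identityˡ _) ⟩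
  1 * suc r ^ suc n   ≡⟨ cong (λ e → 1 * suc r ^ e) (sym (+-identityʳ (suc n))) ⟩
  1 * suc r ^ (suc n + 0) ∎
  where open ≤-Reasoning
negBinomialSum-bound r (suc n) (suc M) = begin
  negBinomialSum (suc n) q (suc M) * (r * r ^ n)
    ≡⟨ cong (_* (r * r ^ n)) (negBinomialSum-pascal n q M) ⟩
  (negBinomialSum n q (suc M) + suc M * negBinomialSum (suc n) q M) * (r * r ^ n)
    ≡⟨ lemma₁ (negBinomialSum n q (suc M)) (suc M) (negBinomialSum (suc n) q M) r (r ^ n) ⟩
  negBinomialSum n q (suc M) * r ^ n * r + suc M * (negBinomialSum (suc n) q M * (r * r ^ n))
    ≤⟨ +-mono-≤ (*-monoˡ-≤ r (negBinomialSum-bound r n (suc M)))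
                (*-monoʳ-≤ (suc M) (negBinomialSum-bound r (suc n) M)) ⟩
  suc M ! * q ^ (n + suc M) * r + suc M * (M ! * q ^ suc (n + M))
    ≡⟨ cong (λ e → suc M ! * q ^ (n + suc M) * r + suc M * (M ! * q ^ e)) (sym (+-suc n M)) ⟩
  suc M ! * q ^ (n + suc M) * r + suc M * (M ! * q ^ (n + suc M))
    ≡⟨ lemma₂ (suc M) (M !) (q ^ (n + suc M)) r ⟩
  suc M ! * (q * q ^ (n + suc M)) ∎
  where
  q = suc r
  open ≤-Reasoning
  lemma₁ : ∀ a s b r x → (a + s * b) * (r * x) ≡ a * x * r + s * (b * (r * x))
  lemma₁ = solve-∀
  lemma₂ : ∀ s f x r → s * f * x * r + s * (f * x) ≡ s * f * (suc r * x)
  lemma₂ = solve-∀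

-- e ≤ (1 − 1/q)^(−q) with q = r + 1: termwise 1/i! ≤ C(q+i−1, i)/q^i, as q^i ≤ q(q+1)⋯(q+i−1).
e≤[1+1/r]^[1+r] : ∀ r M → eNum M * r ^ suc r ≤ M ! * suc r ^ suc r
e≤[1+1/r]^[1+r] r M = *-cancelʳ-≤ _ _ (q ^ M) {{m^n≢0 q M}} (begin
  eNum M * r ^ q * q ^ M        ≡⟨ lemma (eNum M) (r ^ q) (q ^ M) ⟩
  eNum M * q ^ M * r ^ q        ≤⟨ *-monoˡ-≤ (r ^ q) (eNum*^≤negBinomialSum q M) ⟩
  negBinomialSum q q M * r ^ q  ≤⟨ negBinomialSum-bound r q M ⟩
  M ! * q ^ (q + M)             ≡⟨ cong (M ! *_) (^-distribˡ-+-* q q M) ⟩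
  M ! * (q ^ q * q ^ M)         ≡⟨ *-assoc (M !) _ _ ⟨
  M ! * q ^ q * q ^ M           ∎)
  where
  q = suc r
  open ≤-Reasoning
  lemma : ∀ a b c → a * b * c ≡ a * c * b
  lemma = solve-∀

^-distribʳ-* : ∀ x y a → (x * y) ^ a ≡ x ^ a * y ^ a
^-distribʳ-* x y zero    = refl
^-distribʳ-* x y (suc a) rewrite ^-distribʳ-* x y a = lemma x y (x ^ a) (y ^ a)
  where
  lemma : ∀ x y u v → x * y * (u * v) ≡ x * u * (y * v)
  lemma = solve-∀

e^a≤[1+1/r]^m : ∀ r M a m → a * suc r ≤ m → eNum M ^ a * r ^ m ≤ (M !) ^ a * suc r ^ m
e^a≤[1+1/r]^m r M a m a*q≤m with m≤n⇒∃[o]m+o≡n a*q≤m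
... | o , refl = begin
  eNum M ^ a * r ^ (a * q + o)     ≡⟨ regroup (eNum M) r ⟩
  (eNum M * r ^ q) ^ a * r ^ o     ≤⟨ *-mono-≤ (^-monoˡ-≤ a (e≤[1+1/r]^[1+r] r M)) (^-monoˡ-≤ o (n≤1+n r)) ⟩
  (M ! * q ^ q) ^ a * q ^ o        ≡⟨ regroup (M !) q ⟨
  (M !) ^ a * q ^ (a * q + o)      ∎
  where
  q = suc r
  open ≤-Reasoning
  regroup : ∀ x y → x ^ a * y ^ (a * q + o) ≡ (x * y ^ q) ^ a * y ^ o
  regroup x y rewrite ^-distribʳ-* x (y ^ q) a | ^-*-assoc y q a | *-comm q a
                    | ^-distribˡ-+-* y (a * q) o = sym (*-assoc (x ^ a) _ _)

floorHarmonic : ℕ → ℕ → ℕ → ℕ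
floorHarmonic m d zero    = 0
floorHarmonic m d (suc j) = m / suc d + floorHarmonic m (suc d) j

e^floorHarmonic-telescope : ∀ m M d j →
  eNum M ^ floorHarmonic m d j * d ^ m ≤ (M !) ^ floorHarmonic m d j * (d + j) ^ m
e^floorHarmonic-telescope m M d zero rewrite +-identityʳ d = ≤-refl
e^floorHarmonic-telescope m M d (suc j) = begin
  eNum M ^ (a + H) * d ^ m               ≡⟨ regroup (eNum M) (d ^ m) ⟩
  eNum M ^ a * (eNum M ^ H * d ^ m)      ≡⟨ swap (eNum M ^ a) (eNum M ^ H) (d ^ m) ⟩
  eNum M ^ H * (eNum M ^ a * d ^ m)      ≤⟨ *-monoʳ-≤ (eNum M ^ H) (e^a≤[1+1/r]^m d M a m (m/n*n≤m m (suc d))) ⟩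
  eNum M ^ H * ((M !) ^ a * suc d ^ m)   ≡⟨ swap (eNum M ^ H) ((M !) ^ a) (suc d ^ m) ⟩
  (M !) ^ a * (eNum M ^ H * suc d ^ m)   ≤⟨ *-monoʳ-≤ ((M !) ^ a) (e^floorHarmonic-telescope m M (suc d) j) ⟩
  (M !) ^ a * ((M !) ^ H * (suc d + j) ^ m) ≡⟨ cong (λ e → (M !) ^ a * ((M !) ^ H * e ^ m)) (+-suc d j) ⟨
  (M !) ^ a * ((M !) ^ H * (d + suc j) ^ m) ≡⟨ regroup (M !) ((d + suc j) ^ m) ⟨
  (M !) ^ (a + H) * (d + suc j) ^ m      ∎
  where
  a = m / suc d
  H = floorHarmonic m (suc d) j
  open ≤-Reasoning
  swap : ∀ x y z → x * (y * z) ≡ y * (x * z)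
  swap = solve-∀
  regroup : ∀ x z → x ^ (a + H) * z ≡ x ^ a * (x ^ H * z)
  regroup x z rewrite ^-distribˡ-+-* x a H = *-assoc (x ^ a) (x ^ H) z

harmonicTail : ℕ → ℕ → ℕ
harmonicTail m d = floorHarmonic m d (m ∸ d)

harmonicTail-unfold : ∀ m d → harmonicTail m d ≡ m / suc d + harmonicTail m (suc d)
harmonicTail-unfold m d = unfold (m ∸ d) refl
  where
  unfold : ∀ j → m ∸ d ≡ j → floorHarmonic m d j ≡ m / suc d + harmonicTail m (suc d)
  unfold zero m∸d≡0 = sym (cong₂ _+_ (m<n⇒m/n≡0 (s≤s m≤d))
                                      (cong (floorHarmonic m (suc d)) (m≤n⇒m∸n≡0 (m≤n⇒m≤1+n m≤d))))
    where m≤d = m∸n≡0⇒m≤n {m} {d} m∸d≡0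
  unfold (suc j) m∸d≡1+j rewrite sym (pred[m∸n]≡m∸[1+n] m d) | m∸d≡1+j = refl

M!≤eNum : ∀ M → M ! ≤ eNum M
M!≤eNum zero    = ≤-refl
M!≤eNum (suc M) = ≤-trans (*-monoʳ-≤ (suc M) (M!≤eNum M)) (m≤m+n _ 1)

e^y≤N⇒e^x≤N : ∀ M N {x y} → x ≤ y → eNum M ^ y ≤ (M !) ^ y * N → eNum M ^ x ≤ N * (M !) ^ x
e^y≤N⇒e^x≤N M N {x} x≤y e^y≤N with m≤n⇒∃[o]m+o≡n x≤y
... | o , refl = *-cancelʳ-≤ _ _ ((M !) ^ o) {{m^n≢0 (M !) o {{M !≢0}}}} (begin
  eNum M ^ x * (M !) ^ o     ≤⟨ *-monoʳ-≤ (eNum M ^ x) (^-monoˡ-≤ o (M!≤eNum M)) ⟩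
  eNum M ^ x * eNum M ^ o    ≡⟨ ^-distribˡ-+-* (eNum M) x o ⟨
  eNum M ^ (x + o)           ≤⟨ e^y≤N ⟩
  (M !) ^ (x + o) * N        ≡⟨ cong (_* N) (^-distribˡ-+-* (M !) x o) ⟩
  (M !) ^ x * (M !) ^ o * N  ≡⟨ lemma ((M !) ^ x) ((M !) ^ o) N ⟩
  N * (M !) ^ x * (M !) ^ o  ∎)
  where
  open ≤-Reasoning
  lemma : ∀ a b c → a * b * c ≡ c * a * b
  lemma = solve-∀

harmonicTail⇒ExpAtMost : ∀ m c → 1 ≤ m → c ≤ harmonicTail m 0 → ExpAtMost (c ∸ m) (m ^ m)
harmonicTail⇒ExpAtMost (suc m′) c _ c≤H M =
  e^y≤N⇒e^x≤N M (m ^ m) c∸m≤H (begin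
    eNum M ^ H                ≡⟨ *-identityʳ _ ⟨
    eNum M ^ H * 1            ≡⟨ cong (eNum M ^ H *_) (^-zeroˡ m) ⟨
    eNum M ^ H * 1 ^ m        ≤⟨ e^floorHarmonic-telescope m M 1 m′ ⟩
    (M !) ^ H * m ^ m         ∎)
  where
  m = suc m′
  H = floorHarmonic m 1 m′
  open ≤-Reasoning
  c∸m≤H : c ∸ m ≤ H
  c∸m≤H = begin
    c ∸ m              ≤⟨ ∸-monoˡ-≤ m c≤H ⟩
    (m / 1 + H) ∸ m    ≡⟨ cong (λ e → (e + H) ∸ m) (n/1≡n m) ⟩
    (m + H) ∸ m        ≡⟨ m+n∸m≡n m H ⟩
    H                  ∎

m*n≤o⇒m≤o/n : ∀ m n {o} .{{_ : NonZero n}} → m * n ≤ o → m ≤ o / n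
m*n≤o⇒m≤o/n m n {o} m*n≤o = begin
  m          ≡⟨ m*n/n≡m m n ⟨
  m * n / n  ≤⟨ /-monoˡ-≤ n m*n≤o ⟩
  o / n      ∎
  where open ≤-Reasoning

ind : Bool → ℕ
ind b = if b then 1 else 0

ind-∧ : ∀ u v → ind (u ∧ v) ≡ ind u * ind v
ind-∧ true  v = sym (+-identityʳ (ind v))
ind-∧ false v = refl

sum-mono-≤ : ∀ {n} {f g : Fin n → ℕ} → (∀ i → f i ≤ g i) → sum f ≤ sum g
sum-mono-≤ {zero}  f≤g = z≤n
sum-mono-≤ {suc n} f≤g = +-mono-≤ (f≤g zero) (sum-mono-≤ (f≤g ∘ suc))

∑∑-ind-∧ : ∀ {n} (x y : Fin n → Bool) →
  ∑[ i < n ] ∑[ j < n ] ind (x i ∧ y j) ≡ ∑[ i < n ] ind (x i) * ∑[ j < n ] ind (y j)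
∑∑-ind-∧ x y = begin
  sum (λ i → sum (λ j → ind (x i ∧ y j)))    ≡⟨ sum-cong-≗ (λ i → sum-cong-≗ (λ j → ind-∧ (x i) (y j))) ⟩
  sum (λ i → sum (λ j → ind (x i) * ind (y j))) ≡⟨ sum-cong-≗ (λ i → *-distribˡ-sum (ind (x i)) (ind ∘ y)) ⟨
  sum (λ i → ind (x i) * sum (ind ∘ y))       ≡⟨ *-distribʳ-sum (sum (ind ∘ y)) (ind ∘ x) ⟨
  sum (ind ∘ x) * sum (ind ∘ y)               ∎
  where open ≡-Reasoning

sum-tabulate : ∀ n (f : Fin n → ℕ) → List.sum (tabulate f) ≡ sum f
sum-tabulate zero    f = refl
sum-tabulate (suc n) f = cong (f zero +_) (sum-tabulate n (f ∘ suc))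

sum-map-allFin : ∀ n (f : Fin n → ℕ) → List.sum (map f (allFin n)) ≡ sum f
sum-map-allFin n f = trans (cong List.sum (map-tabulate id f)) (sum-tabulate n f)

arcsInto : ∀ {n} → (Fin n → Fin n → Bool) → (Fin n → Bool) → ℕ
arcsInto {n} A c = ∑[ i < n ] ∑[ j < n ] ind (A i j ∧ (not (c i) ∧ c j))

arcsInto-congˡ : ∀ {n} {A A′ : Fin n → Fin n → Bool} (c : Fin n → Bool) →
  (∀ i j → A i j ≡ A′ i j) → arcsInto A c ≡ arcsInto A′ c
arcsInto-congˡ c A≡A′ = sum-cong-≗ λ i → sum-cong-≗ λ j → cong (λ a → ind (a ∧ (not (c i) ∧ c j))) (A≡A′ i j)

arcsInto-congʳ : ∀ {n} (A : Fin n → Fin n → Bool) {c c′ : Fin n → Bool} →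
  (∀ i → c i ≡ c′ i) → arcsInto A c ≡ arcsInto A c′
arcsInto-congʳ A c≡c′ = sum-cong-≗ λ i → sum-cong-≗ λ j →
  cong₂ (λ u v → ind (A i j ∧ (not u ∧ v))) (c≡c′ i) (c≡c′ j)

arcsBetween-permute : ∀ {n} (E : Digraph n) (π : Ordering n) (c : Fin n → Bool) →
  arcsBetween E (not ∘ c) c ≡ arcsInto (λ i j → E (π ⟨$⟩ʳ i) (π ⟨$⟩ʳ j)) (c ∘ (π ⟨$⟩ʳ_))
arcsBetween-permute {n} E π c = begin
  List.sum (map (λ u → List.sum (map (λ w → ind (P u w)) (allFin n))) (allFin n))
    ≡⟨ sum-map-allFin n _ ⟩
  ∑[ u < n ] List.sum (map (λ w → ind (P u w)) (allFin n))
    ≡⟨ sum-cong-≗ (λ u → sum-map-allFin n (λ w → ind (P u w))) ⟩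
  ∑[ u < n ] ∑[ w < n ] ind (P u w)
    ≡⟨ sum-permute (λ u → ∑[ w < n ] ind (P u w)) π ⟩
  ∑[ i < n ] ∑[ w < n ] ind (P (π ⟨$⟩ʳ i) w)
    ≡⟨ sum-cong-≗ (λ i → sum-permute (λ w → ind (P (π ⟨$⟩ʳ i) w)) π) ⟩
  ∑[ i < n ] ∑[ j < n ] ind (P (π ⟨$⟩ʳ i) (π ⟨$⟩ʳ j)) ∎
  where
  open ≡-Reasoning
  P : Fin n → Fin n → Bool
  P u w = E u w ∧ (not (c u) ∧ c w)

before : ∀ {n} → ℕ → Fin n → Bool
before t i = toℕ i <ᵇ t

⌊<?⌋≡<ᵇ : ∀ a c → ⌊ a <? c ⌋ ≡ (a <ᵇ c)
⌊<?⌋≡<ᵇ a c = isYes≗does (a <? c)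

pos-⟨$⟩ʳ : ∀ {n} (π : Ordering n) i → pos π (π ⟨$⟩ʳ i) ≡ toℕ i
pos-⟨$⟩ʳ π i = cong toℕ (inverseˡ π)

prefix-⟨$⟩ʳ : ∀ {n} (π : Ordering n) t i → prefix π t (π ⟨$⟩ʳ i) ≡ before t i
prefix-⟨$⟩ʳ π t i = trans (⌊<?⌋≡<ᵇ _ t) (cong (_<ᵇ t) (pos-⟨$⟩ʳ π i))

transTournament-⟨$⟩ʳ : ∀ {n} (π : Ordering n) i j →
  transTournament π (π ⟨$⟩ʳ i) (π ⟨$⟩ʳ j) ≡ (toℕ i <ᵇ toℕ j)
transTournament-⟨$⟩ʳ π i j = trans (⌊<?⌋≡<ᵇ _ _) (cong₂ _<ᵇ_ (pos-⟨$⟩ʳ π i) (pos-⟨$⟩ʳ π j))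

zerosBelow : ∀ {n} → ℕ → (Fin n → Bool) → ℕ
zerosBelow {n} t b = ∑[ i < n ] ind (before t i ∧ not (b i))

onesFrom : ∀ {n} → ℕ → (Fin n → Bool) → ℕ
onesFrom {n} t b = ∑[ j < n ] ind (not (before t j) ∧ b j)

inversions : ∀ {n} → (Fin n → Bool) → ℕ
inversions = arcsInto (λ i j → toℕ i <ᵇ toℕ j)

zerosBelow-zero : ∀ {n} (b : Fin n → Bool) → zerosBelow 0 b ≡ 0
zerosBelow-zero {n} b = sum-replicate-zero n

onesFrom-≥ : ∀ {n} t (b : Fin n → Bool) → n ≤ t → onesFrom t b ≡ 0
onesFrom-≥ {zero}  t       b _         = refl
onesFrom-≥ {suc n} (suc t) b (s≤s n≤t) = onesFrom-≥ t (b ∘ suc) n≤t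

-- d counts the zeros already removed from the front of the string.
inversions≤harmonicTail : ∀ m {n} (b : Fin n → Bool) d →
  (∀ t → (d + zerosBelow t b) * onesFrom t b ≤ m) → inversions b ≤ harmonicTail m d
inversions≤harmonicTail m {zero}  b d _ = z≤n
inversions≤harmonicTail m {suc n} b d h = peel (b zero) (h ∘ suc)
  where
  b′ = b ∘ suc
  peel : ∀ x → (∀ t → (d + (ind (not x) + zerosBelow t b′)) * onesFrom t b′ ≤ m) →
         ∑[ j < n ] ind (not x ∧ b′ j) + inversions b′ ≤ harmonicTail m d
  peel true  h′ rewrite sum-replicate-zero n = inversions≤harmonicTail m b′ d h′
  peel false h′ = begin
    onesFrom 0 b′ + inversions b′         ≤⟨ +-mono-≤ ones≤ rest≤ ⟩
    m / suc d + harmonicTail m (suc d)    ≡⟨ harmonicTail-unfold m d ⟨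
    harmonicTail m d                      ∎
    where
    open ≤-Reasoning
    ones≤ : onesFrom 0 b′ ≤ m / suc d
    ones≤ = m*n≤o⇒m≤o/n (onesFrom 0 b′) (suc d) (begin
      onesFrom 0 b′ * suc d                       ≡⟨ *-comm (onesFrom 0 b′) (suc d) ⟩
      suc d * onesFrom 0 b′                       ≡⟨ cong (_* onesFrom 0 b′) d+1+zeros≡1+d ⟨
      (d + (1 + zerosBelow 0 b′)) * onesFrom 0 b′ ≤⟨ h′ 0 ⟩
      m                                           ∎)
      where
      d+1+zeros≡1+d : d + (1 + zerosBelow 0 b′) ≡ suc d
      d+1+zeros≡1+d = trans (cong (λ z → d + (1 + z)) (zerosBelow-zero b′)) (+-comm d 1)
    rest≤ : inversions b′ ≤ harmonicTail m (suc d)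
    rest≤ = inversions≤harmonicTail m b′ (suc d) λ t →
      subst (λ z → z * onesFrom t b′ ≤ m) (+-suc d (zerosBelow t b′)) (h′ t)

split-pair-covered : ∀ bᵢ bⱼ pᵢ pⱼ aᵢⱼ aⱼᵢ → (bᵢ ≡ false → bⱼ ≡ true → aᵢⱼ ≡ true ⊎ aⱼᵢ ≡ true) →
  ind ((pᵢ ∧ not bᵢ) ∧ (not pⱼ ∧ bⱼ)) ≤ ind (aᵢⱼ ∧ (not bᵢ ∧ bⱼ)) + ind (aⱼᵢ ∧ (not pⱼ ∧ pᵢ))
split-pair-covered _     _     false _     _   _   _ = z≤n
split-pair-covered true  _     true  _     _   _   _ = z≤n
split-pair-covered false _     true  true  _   _   _ = z≤n
split-pair-covered false false true  false _   _   _ = z≤n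
split-pair-covered false true  true  false aᵢⱼ aⱼᵢ arc with arc refl refl
... | inj₁ refl = s≤s z≤n
... | inj₂ refl = m≤n+m 1 (ind (aᵢⱼ ∧ true))

zerosBelow*onesFrom≤arcsInto : ∀ {n} (A : Fin n → Fin n → Bool) (b : Fin n → Bool) →
  (∀ i j → b i ≡ false → b j ≡ true → A i j ≡ true ⊎ A j i ≡ true) →
  ∀ t → zerosBelow t b * onesFrom t b ≤ arcsInto A b + arcsInto A (before t)
zerosBelow*onesFrom≤arcsInto {n} A b arc t = begin
  zerosBelow t b * onesFrom t b
    ≡⟨ ∑∑-ind-∧ (λ i → before t i ∧ not (b i)) (λ j → not (before t j) ∧ b j) ⟨
  ∑[ i < n ] ∑[ j < n ] ind ((p i ∧ not (b i)) ∧ (not (p j) ∧ b j))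
    ≤⟨ sum-mono-≤ (λ i → sum-mono-≤ λ j →
         split-pair-covered (b i) (b j) (p i) (p j) (A i j) (A j i) (arc i j)) ⟩
  ∑[ i < n ] ∑[ j < n ] (cut i j + back j i)
    ≡⟨ sum-cong-≗ (λ i → ∑-distrib-+ (cut i) (λ j → back j i)) ⟩
  ∑[ i < n ] (∑[ j < n ] cut i j + ∑[ j < n ] back j i)
    ≡⟨ ∑-distrib-+ (λ i → ∑[ j < n ] cut i j) (λ i → ∑[ j < n ] back j i) ⟩
  arcsInto A b + ∑[ i < n ] ∑[ j < n ] back j i
    ≡⟨ cong (arcsInto A b +_) (∑-comm (λ i j → back j i)) ⟩
  arcsInto A b + arcsInto A p ∎
  where
  open ≤-Reasoning
  p = before t
  cut back : Fin n → Fin n → ℕ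
  cut  i j = ind (A i j ∧ (not (b i) ∧ b j))
  back i j = ind (A i j ∧ (not (p i) ∧ p j))

zerosBelow*onesFrom≤2k : ∀ {n} k (A : Fin n → Fin n → Bool) (b : Fin n → Bool) →
  (∀ i j → b i ≡ false → b j ≡ true → A i j ≡ true ⊎ A j i ≡ true) →
  arcsInto A b ≤ k → (∀ t → 1 ≤ t → t < n → arcsInto A (before t) ≤ k) →
  ∀ t → zerosBelow t b * onesFrom t b ≤ 2 * k
zerosBelow*onesFrom≤2k {n} k A b arc cut width zero rewrite zerosBelow-zero b = z≤n
zerosBelow*onesFrom≤2k {n} k A b arc cut width (suc t) with suc t <? n
... | no  t≮n rewrite onesFrom-≥ (suc t) b (≮⇒≥ t≮n) | *-zeroʳ (zerosBelow (suc t) b) = z≤n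
... | yes t<n = begin
  zerosBelow (suc t) b * onesFrom (suc t) b  ≤⟨ zerosBelow*onesFrom≤arcsInto A b arc (suc t) ⟩
  arcsInto A b + arcsInto A (before (suc t)) ≤⟨ +-mono-≤ cut (width (suc t) (s≤s z≤n) t<n) ⟩
  k + k                                      ≡⟨ cong (k +_) (+-identityʳ k) ⟨
  2 * k                                      ∎
  where open ≤-Reasoning

backArcs-permute : ∀ {n} (E : Digraph n) (π : Ordering n) t →
  backArcs E π t ≡ arcsInto (λ i j → E (π ⟨$⟩ʳ i) (π ⟨$⟩ʳ j)) (before t)
backArcs-permute E π t =
  trans (arcsBetween-permute E π (prefix π t)) (arcsInto-congʳ (λ i j → E (π ⟨$⟩ʳ i) (π ⟨$⟩ʳ j)) (prefix-⟨$⟩ʳ π t))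

cutBackArcs-transTournament : ∀ {n} (π : Ordering n) X →
  cutBackArcs (transTournament π) X ≡ inversions (X ∘ (π ⟨$⟩ʳ_))
cutBackArcs-transTournament π X =
  trans (arcsBetween-permute (transTournament π) π X) (arcsInto-congˡ (X ∘ (π ⟨$⟩ʳ_)) (transTournament-⟨$⟩ʳ π))

lemma3p8 : (k n : ℕ) → 1 ≤ k → (T : Digraph n) → SemiComplete T →
    (π : Ordering n) → WidthAtMost T π k →
    (X : Fin n → Bool) → IsCut T k X → Is2k1ln2kCut (transTournament π) k X
lemma3p8 k n 1≤k T (_ , semiComplete) π width X cut =
  -- the second disjunct also covers c ≤ 2k, where c ∸ 2k = 0
  inj₂ (harmonicTail⇒ExpAtMost (2 * k) _ (≤-trans 1≤k (m≤m+n k (k + 0))) (begin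
    cutBackArcs (transTournament π) X ≡⟨ cutBackArcs-transTournament π X ⟩
    inversions b                      ≤⟨ inversions≤harmonicTail (2 * k) b 0 split≤2k ⟩
    harmonicTail (2 * k) 0            ∎))
  where
  open ≤-Reasoning
  σ = π ⟨$⟩ʳ_
  A : Fin n → Fin n → Bool
  A i j = T (σ i) (σ j)
  b = X ∘ σ
  arc : ∀ i j → b i ≡ false → b j ≡ true → A i j ≡ true ⊎ A j i ≡ true
  arc i j bᵢ≡false bⱼ≡true = semiComplete (σ i) (σ j) λ σi≡σj →
    contradiction (trans (sym bᵢ≡false) (trans (cong X σi≡σj) bⱼ≡true)) λ ()
  split≤2k : ∀ t → zerosBelow t b * onesFrom t b ≤ 2 * k
  split≤2k = zerosBelow*onesFrom≤2k k A b arc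
    (subst (_≤ k) (arcsBetween-permute T π X) cut)
    (λ t 1≤t t<n → subst (_≤ k) (backArcs-permute T π t) (width t 1≤t t<n))
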